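{- Let $G=(V,A)$ be an Eulerian digraph, $s_1\neq s_2$ vertices, and $\mathcal{C}_1$ the set of recurrent configurations with respect to sink $s_1$. If $c\in\mathcal{C}_1$ is minimum, i.e. $\sum_{v\ne s_1}c(v)$ is minimal over all configurations in $\mathcal{C}_1$, then its swap number $\mathcal{I}_{s_2}(c)$ equals $0$.
   Context: All digraphs are finite multi-digraphs without loops; $\deg_G(u,w)$ is the number of arcs from $u$ to $w$, $\deg^\pm_G$ out/in-degree. $G$ is Eulerian if connected and $\deg^-_G(v)=\deg^+_G(v)$ for all $v$. Chip-firing game with sink $s$: configurations are maps $c:V\setminus\{s\}\to\mathbb{N}$; $v\neq s$ is firable if $c(v)\ge\deg^+_G(v)$; firing $v$ decreases $c(v)$ by $\deg^+_G(v)$ and increases $c(w)$ by $\deg_G(v,w)$ for $w\notin\{v,s\}$; $s$ never fires. Repeated firing gives a unique stable configuration $c^\circ$. A stable $c$ is recurrent if for every configuration $d$ there is a configuration $d'$ with $(d+d')^\circ=c$. For a map $x:V\to\mathbb{N}$ and a vertex $s$, $x^{\circ s}:V\to\mathbb{N}$ is obtained by repeatedly firing vertices $v\ne s$ with $x(v)\ge\deg^+_G(v)$, where firing $v$ decreases $x(v)$ by $\deg^+_G(v)$ and increases $x(w)$ by $\deg_G(v,w)$ for every $w\ne v$ (including $w=s$; chips on $s$ are kept), until no vertex other than $s$ is firable; this is well defined. For a configuration $c:V\setminus\{s_1\}\to\mathbb{N}$ and $i\in\mathbb{N}$, $\overline{c}^{\,i}:V\to\mathbb{N}$ equals $c$ on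 $V\setminus\{s_1\}$ and $\deg^+_G(s_1)+i$ at $s_1$. For $c\in\mathcal{C}_1$, the swap number $\mathcal{I}_{s_2}(c)$ is the smallest $i\in\mathbb{N}$ with $\left(\overline{c}^{\,i}\right)^{\circ s_2}(s_2)=\deg^+_G(s_2)+i$ (such $i$ always exists). -}

module Defs where

open import Data.Nat using (ℕ; _+_; _∸_; _≤_; _<_; _>_)
open import Data.Fin using (Fin; _≟_)
open import Data.List using (List; tabulate; filter)
open import Data.Nat.ListAction using (sum)
open import Data.Product using (Σ; ∃; _×_; _,_)
open import Data.Sum using (_⊎_)
open import Relation.Nullary using (¬_; yes; no)
open import Relation.Nullary.Decidable using (¬?)
open import Relation.Binary.PropositionalEquality using (_≡_; _≢_)
open import Relation.Binary.Construct.Closure.ReflexiveTransitive using (Star)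

-- A finite multi-digraph without loops on vertex set Fin n;
-- deg u w = number of arcs from u to w.
record Digraph : Set where
  field
    n       : ℕ
    deg     : Fin n → Fin n → ℕ
    noLoops : ∀ v → deg v v ≡ 0

module _ (G : Digraph) where
  open Digraph G

  V : Set
  V = Fin n

  outdeg : V → ℕ
  outdeg v = sum (tabulate (λ w → deg v w))

  indeg : V → ℕ
  indeg v = sum (tabulate (λ u → deg u v))

  Adj : V → V → Set
  Adj u w = deg u w > 0 ⊎ deg w u > 0

  Connected : Set
  Connected = ∀ u w → Star Adj u w

  Eulerian : Set
  Eulerian = Connected × (∀ v → indeg v ≡ outdeg v)

  -- maps V → ℕ (for sink configurations the value at the sink is ignored)
  Config : Set
  Config = V → ℕ

  fireAt : V → Config → Config
  fireAt v x w with w ≟ v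
  ... | yes _ = x w ∸ outdeg v
  ... | no  _ = x w + deg v w

  -- fire v in the chip-firing game with sink s: chips sent to s vanish
  fireSink : V → V → Config → Config
  fireSink s v x w with w ≟ s
  ... | yes _ = x w
  ... | no  _ = fireAt v x w

  SinkStep : V → Config → Config → Set
  SinkStep s x y = ∃ λ v → v ≢ s × outdeg v ≤ x v × y ≡ fireSink s v x

  KeepStep : V → Config → Config → Set
  KeepStep s x y = ∃ λ v → v ≢ s × outdeg v ≤ x v × y ≡ fireAt v x

  Stable : V → Config → Set
  Stable s c = ∀ v → v ≢ s → c v < outdeg v

  StabilizesTo : V → Config → Config → Set
  StabilizesTo s c e = Star (SinkStep s) c e × Stable s e

  KeepStabilizesTo : V → Config → Config → Set
  KeepStabilizesTo s x y = Star (KeepStep s) x y × Stable s y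

  _⊕_ : Config → Config → Config
  (c ⊕ d) v = c v + d v

  Recurrent : V → Config → Set
  Recurrent s c =
    Stable s c ×
    (∀ (d : Config) → ∃ λ (d' : Config) → ∃ λ (e : Config) →
       StabilizesTo s (d ⊕ d') e × (∀ v → v ≢ s → e v ≡ c v))

  weight : V → Config → ℕ
  weight s c = sum (Data.List.map c (filter (λ v → ¬? (v ≟ s)) (tabulate (λ v → v))))

  MinimumRecurrent : V → Config → Set
  MinimumRecurrent s c =
    Recurrent s c × (∀ c' → Recurrent s c' → weight s c ≤ weight s c')

  lift : V → Config → ℕ → Config
  lift s₁ c i v with v ≟ s₁
  ... | yes _ = outdeg s₁ + i
  ... | no  _ = c v

  SwapCond : V → V → Config → ℕ → Set
  SwapCond s₁ s₂ c i =
    ∃ λ (y : Config) → KeepStabilizesTo s₂ (lift s₁ c i) y × y s₂ ≡ outdeg s₂ + i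

  IsSwapNumber : V → V → Config → ℕ → Set
  IsSwapNumber s₁ s₂ c i = SwapCond s₁ s₂ c i × (∀ j → j < i → ¬ SwapCond s₁ s₂ c j)

-- An ordering π of the vertices determines the configuration configOf π, in which every
-- vertex holds one chip per arc coming from a later vertex of π.  Its chips add up to the
-- number backArcs π of backward arcs, and in an Eulerian digraph the first vertex holds
-- exactly its out-degree.  Stabilizing deg⁺ + d towards a recurrent c and listing the
-- vertices by their last firing gives an ordering π₀ = s₁ ∷ ℓ with configOf π₀ ≤ c, and
-- stable ordering configurations are recurrent, so minimality forces c = configOf π₀ off s₁
-- and makes π₀ minimise the number of backward arcs.
--
-- Now add s₁'s chips and stabilize with s₂ as the sink.  Firing the vertices in front of s₂
-- rotates it to the head of the ordering.  Then grow a stable prefix behind s₂: the first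
-- remaining vertex joins it if it receives an arc from the prefix, is fired to the back if it
-- has no arc to or from the prefix, and otherwise could be moved to the back with fewer
-- backward arcs, which minimality of π₀ rules out.  The process ends in the configuration of
-- an ordering headed by s₂, where s₂ holds exactly deg⁺ s₂ chips.

module Submission where

open import Defs
open import Data.Empty using (⊥-elim)
open import Data.Fin using (_≟_)
open import Data.List using (List; []; _∷_; _++_; [_]; map; filter; allFin; length)
open import Data.List.Extrema.Nat using (argmax; f[xs]≤f[argmax])
open import Data.List.Membership.Propositional using (_∈_; _∉_)
open import Data.List.Membership.Propositional.Properties
  using (∈-allFin; ∈-++⁺ˡ; ∈-++⁺ʳ; ∈-++⁻; ∈-∃++; ∈-filter⁺; ∈-filter⁻)
open import Data.List.Membership.Propositional.Properties.WithK using (unique∧set⇒bag)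
open import Data.List.Properties using (map-++; map-tabulate; ++-assoc; ++-identityʳ)
open import Data.List.Relation.Binary.BagAndSetEquality using (∼bag⇒↭)
open import Data.List.Relation.Binary.Permutation.Propositional using (_↭_; ↭-sym; ↭-trans; ↭⇒↭ₛ)
open import Data.List.Relation.Binary.Permutation.Propositional.Properties
  using (map⁺; ∈-resp-↭; ++⁺ˡ; ++-comm; ↭-length)
open import Data.List.Relation.Binary.Permutation.Setoid.Properties using (Unique-resp-↭)
open import Data.List.Relation.Unary.All using (All; []; _∷_)
import Data.List.Relation.Unary.All as All
open import Data.List.Relation.Unary.All.Properties using (¬Any⇒All¬)
open import Data.List.Relation.Unary.Any using (here; there)
import Data.List.Relation.Unary.First as First
open import Data.List.Relation.Unary.First.Properties using (toView)
open import Data.List.Relation.Unary.Unique.Propositional using (Unique; []; _∷_)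
open import Data.List.Relation.Unary.Unique.Propositional.Properties using (tabulate⁺)
open import Data.Nat using (ℕ; zero; suc; _+_; _*_; _∸_; _≤_; _<_; z≤n; s≤s)
open import Data.Nat.ListAction using (sum)
open import Data.Nat.ListAction.Properties using (sum-++; sum-↭)
open import Data.Nat.Properties hiding (_≟_)
open import Algebra.Properties.CommutativeSemigroup +-commutativeSemigroup
  using (interchange; x∙yz≈y∙xz; xy∙z≈xz∙y)
open import Data.Nat.Tactic.RingSolver using (solve-∀)
open import Data.Product using (∃-syntax; _×_; _,_; proj₁; proj₂)
open import Data.Sum using (_⊎_; inj₁; inj₂)
open import Function.Base using (id)
open import Function.Bundles using (mk⇔)
open import Relation.Binary.Construct.Closure.ReflexiveTransitive using (Star; ε; _◅_; _◅◅_)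
open import Relation.Binary.Definitions using (DecidableEquality)
open import Relation.Binary.PropositionalEquality
  using (_≡_; _≢_; _≗_; setoid; refl; sym; trans; cong; cong₂; subst; subst₂; module ≡-Reasoning)
open import Relation.Nullary using (¬_; yes; no)
open import Relation.Nullary.Decidable using (¬?; decidable-stable)

module _ {A : Set} where

  sumOver : List A → (A → ℕ) → ℕ
  sumOver xs g = sum (map g xs)

  sumOver-++ : ∀ xs ys (g : A → ℕ) → sumOver (xs ++ ys) g ≡ sumOver xs g + sumOver ys g
  sumOver-++ xs ys g = trans (cong sum (map-++ g xs ys)) (sum-++ (map g xs) (map g ys))

  sumOver-↭ : ∀ {xs ys} (g : A → ℕ) → xs ↭ ys → sumOver xs g ≡ sumOver ys g
  sumOver-↭ g p = sum-↭ (map⁺ g p)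

  sumOver-cong : ∀ xs {g h : A → ℕ} → (∀ {x} → x ∈ xs → g x ≡ h x) → sumOver xs g ≡ sumOver xs h
  sumOver-cong []       e = refl
  sumOver-cong (x ∷ xs) e = cong₂ _+_ (e (here refl)) (sumOver-cong xs (λ y∈ → e (there y∈)))

  sumOver-mono : ∀ xs {g h : A → ℕ} → (∀ {x} → x ∈ xs → g x ≤ h x) → sumOver xs g ≤ sumOver xs h
  sumOver-mono []       e = z≤n
  sumOver-mono (x ∷ xs) e = +-mono-≤ (e (here refl)) (sumOver-mono xs (λ y∈ → e (there y∈)))

  sumOver-+ : ∀ xs (g h : A → ℕ) → sumOver xs (λ x → g x + h x) ≡ sumOver xs g + sumOver xs h
  sumOver-+ []       g h = refl
  sumOver-+ (x ∷ xs) g h = begin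
    g x + h x + sumOver xs (λ x → g x + h x)   ≡⟨ cong (g x + h x +_) (sumOver-+ xs g h) ⟩
    g x + h x + (sumOver xs g + sumOver xs h)  ≡⟨ interchange (g x) (h x) _ _ ⟩
    g x + sumOver xs g + (h x + sumOver xs h)  ∎
    where open ≡-Reasoning

  sumOver-* : ∀ xs k (g : A → ℕ) → sumOver xs (λ x → k * g x) ≡ k * sumOver xs g
  sumOver-* []       k g = sym (*-zeroʳ k)
  sumOver-* (x ∷ xs) k g = trans (cong (k * g x +_) (sumOver-* xs k g)) (sym (*-distribˡ-+ k (g x) _))

  sumOver-zero : ∀ xs {g : A → ℕ} → (∀ {x} → x ∈ xs → g x ≡ 0) → sumOver xs g ≡ 0
  sumOver-zero []       e = refl
  sumOver-zero (x ∷ xs) e = cong₂ _+_ (e (here refl)) (sumOver-zero xs (λ y∈ → e (there y∈)))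

  ∈⇒≤sumOver : ∀ {x xs} (g : A → ℕ) → x ∈ xs → g x ≤ sumOver xs g
  ∈⇒≤sumOver {xs = y ∷ xs} g (here refl) = m≤m+n (g y) _
  ∈⇒≤sumOver {xs = y ∷ xs} g (there x∈)  = ≤-trans (∈⇒≤sumOver g x∈) (m≤n+m _ (g y))

  sumOver-single : ∀ {w xs} (g : A → ℕ) → Unique xs → w ∈ xs → (∀ {x} → x ≢ w → g x ≡ 0) →
                   sumOver xs g ≡ g w
  sumOver-single {w} {x ∷ xs} g (x∉xs ∷ u) (here refl) g0 = begin
    g x + sumOver xs g ≡⟨ cong (g x +_) (sumOver-zero xs (λ y∈ → g0 (λ { refl → All.lookup x∉xs y∈ refl }))) ⟩
    g x + 0            ≡⟨ +-identityʳ (g x) ⟩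
    g x                ∎
    where open ≡-Reasoning
  sumOver-single {w} {x ∷ xs} g (x∉xs ∷ u) (there w∈) g0 =
    cong₂ _+_ (g0 (λ { refl → All.lookup x∉xs w∈ refl })) (sumOver-single g u w∈ g0)

  ≤-pointwise∧sumOver-≥⇒≡ : ∀ xs {g h : A → ℕ} → (∀ {x} → x ∈ xs → g x ≤ h x) →
                            sumOver xs h ≤ sumOver xs g → ∀ {x} → x ∈ xs → g x ≡ h x
  ≤-pointwise∧sumOver-≥⇒≡ (y ∷ xs) {g} {h} g≤h h≤g = λ
    { (here refl) → ≤-antisym (g≤h (here refl)) head≥
    ; (there x∈)  → ≤-pointwise∧sumOver-≥⇒≡ xs (λ z∈ → g≤h (there z∈)) tail≥ x∈ }
    where
    head≥ : h y ≤ g y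
    head≥ = +-cancelʳ-≤ (sumOver xs g) _ _
      (≤-trans (+-monoʳ-≤ (h y) (sumOver-mono xs (λ z∈ → g≤h (there z∈)))) h≤g)
    tail≥ : sumOver xs h ≤ sumOver xs g
    tail≥ = +-cancelˡ-≤ (g y) _ _ (≤-trans (+-monoˡ-≤ (sumOver xs h) (g≤h (here refl))) h≤g)

  sumOver-remove : (_≟ᴬ_ : DecidableEquality A) → ∀ {s xs} (g : A → ℕ) → Unique xs → s ∈ xs →
                   sumOver xs g ≡ g s + sumOver (filter (λ v → ¬? (v ≟ᴬ s)) xs) g
  sumOver-remove _≟ᴬ_ {s} {x ∷ xs} g (x∉xs ∷ u) s∈ with x ≟ᴬ s | s∈
  ... | yes refl | _          = cong (g x +_) (sym (filter-all xs (λ y∈ → All.lookup x∉xs y∈)))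
    where
    filter-all : ∀ ys → (∀ {y} → y ∈ ys → s ≢ y) →
                 sumOver (filter (λ v → ¬? (v ≟ᴬ s)) ys) g ≡ sumOver ys g
    filter-all []       _   = refl
    filter-all (y ∷ ys) s∉ with y ≟ᴬ s
    ... | yes refl = ⊥-elim (s∉ (here refl) refl)
    ... | no _     = cong (g y +_) (filter-all ys (λ z∈ → s∉ (there z∈)))
  ... | no x≢s   | here refl  = ⊥-elim (x≢s refl)
  ... | no _     | there s∈xs = begin
    g x + sumOver xs g                                             ≡⟨ cong (g x +_) (sumOver-remove _≟ᴬ_ g u s∈xs) ⟩
    g x + (g s + sumOver (filter (λ v → ¬? (v ≟ᴬ s)) xs) g)        ≡⟨ x∙yz≈y∙xz (g x) (g s) _ ⟩
    g s + (g x + sumOver (filter (λ v → ¬? (v ≟ᴬ s)) xs) g)        ∎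
    where open ≡-Reasoning

  ++-disjoint : ∀ xs {ys} {x : A} → Unique (xs ++ ys) → x ∈ xs → x ∉ ys
  ++-disjoint (y ∷ xs) (y∉ ∷ _) (here refl) x∈ys = All.lookup y∉ (∈-++⁺ʳ xs x∈ys) refl
  ++-disjoint (y ∷ xs) (_ ∷ u)  (there x∈)  x∈ys = ++-disjoint xs u x∈ x∈ys

  ++-uniqueʳ : ∀ xs {ys : List A} → Unique (xs ++ ys) → Unique ys
  ++-uniqueʳ []       u       = u
  ++-uniqueʳ (x ∷ xs) (_ ∷ u) = ++-uniqueʳ xs u

  unique-middle : ∀ xs {v : A} {ys} → Unique (xs ++ v ∷ ys) → v ∉ xs × v ∉ ys
  unique-middle xs u with ++-uniqueʳ xs u
  ... | v∉ys ∷ _ = (λ v∈xs → ++-disjoint xs u v∈xs (here refl)) , (λ v∈ys → All.lookup v∉ys v∈ys refl)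

+-*-distribˡ : ∀ y o f p → y + o * (f + p) ≡ y + o * f + o * p
+-*-distribˡ y o f p = trans (cong (y +_) (*-distribˡ-+ o f p)) (sym (+-assoc y _ _))

module ChipFiring (G : Digraph) where
  open Digraph G
  open import Data.List.Membership.DecPropositional (_≟_ {n}) using (_∈?_)

  Vertex : Set
  Vertex = V G

  -- Orderings and their configurations

  vertices : List Vertex
  vertices = allFin n

  vertices-unique : Unique vertices
  vertices-unique = tabulate⁺ id

  IsOrdering : List Vertex → Set
  IsOrdering π = π ↭ vertices

  ordering-unique : ∀ {π} → IsOrdering π → Unique π
  ordering-unique p = Unique-resp-↭ (setoid Vertex) (↭⇒↭ₛ (↭-sym p)) vertices-unique

  ∈-ordering : ∀ {π} → IsOrdering π → ∀ v → v ∈ π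
  ∈-ordering p v = ∈-resp-↭ (↭-sym p) (∈-allFin v)

  unique∧complete⇒ordering : ∀ {π} → Unique π → (∀ v → v ∈ π) → IsOrdering π
  unique∧complete⇒ordering u complete =
    ∼bag⇒↭ (unique∧set⇒bag u vertices-unique (mk⇔ (λ _ → ∈-allFin _) (λ _ → complete _)))

  inFrom : List Vertex → Vertex → ℕ
  inFrom xs v = sumOver xs (λ u → deg u v)

  outTo : List Vertex → Vertex → ℕ
  outTo xs v = sumOver xs (deg v)

  inFrom-ordering : ∀ {π} → IsOrdering π → ∀ v → inFrom π v ≡ indeg G v
  inFrom-ordering p v = trans (sumOver-↭ _ p) (cong sum (map-tabulate id (λ u → deg u v)))

  outTo-ordering : ∀ {π} → IsOrdering π → ∀ v → outTo π v ≡ outdeg G v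
  outTo-ordering p v = trans (sumOver-↭ _ p) (cong sum (map-tabulate id (deg v)))

  configOf : List Vertex → Config G
  configOf []      v = 0
  configOf (w ∷ ρ) v with v ≟ w
  ... | yes _ = inFrom ρ v
  ... | no  _ = configOf ρ v

  configOf-head : ∀ h ρ → configOf (h ∷ ρ) h ≡ inFrom ρ h
  configOf-head h ρ with h ≟ h
  ... | yes _   = refl
  ... | no h≢h  = ⊥-elim (h≢h refl)

  configOf-tail : ∀ {h w} ρ → w ≢ h → configOf (h ∷ ρ) w ≡ configOf ρ w
  configOf-tail {h} {w} ρ w≢h with w ≟ h
  ... | yes w≡h = ⊥-elim (w≢h w≡h)
  ... | no  _   = refl

  configOf-++-∉ : ∀ P {X w} → w ∉ P → configOf (P ++ X) w ≡ configOf X w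
  configOf-++-∉ []      w∉ = refl
  configOf-++-∉ (p ∷ P) w∉ =
    trans (configOf-tail (P ++ _) (λ w≡p → w∉ (here w≡p))) (configOf-++-∉ P (λ w∈ → w∉ (there w∈)))

  configOf-++-∈ : ∀ P X {w} → w ∈ P → configOf (P ++ X) w ≡ configOf P w + inFrom X w
  configOf-++-∈ (p ∷ P) X {w} w∈ with w ≟ p | w∈
  ... | yes _   | _          = sumOver-++ P X _
  ... | no  w≢p | here w≡p   = ⊥-elim (w≢p w≡p)
  ... | no  _   | there w∈P  = configOf-++-∈ P X w∈P

  configOf-++-↭ : ∀ P {X Y w} → w ∈ P → X ↭ Y → configOf (P ++ X) w ≡ configOf (P ++ Y) w
  configOf-++-↭ P {X} {Y} {w} w∈ X↭Y = begin
    configOf (P ++ X) w         ≡⟨ configOf-++-∈ P X w∈ ⟩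
    configOf P w + inFrom X w   ≡⟨ cong (configOf P w +_) (sumOver-↭ _ X↭Y) ⟩
    configOf P w + inFrom Y w   ≡⟨ configOf-++-∈ P Y w∈ ⟨
    configOf (P ++ Y) w         ∎
    where open ≡-Reasoning

  outTo-split : ∀ P {v} R → IsOrdering (P ++ v ∷ R) → outTo P v + outTo R v ≡ outdeg G v
  outTo-split P {v} R ord = begin
    outTo P v + outTo R v              ≡⟨ cong (λ k → outTo P v + (k + outTo R v)) (noLoops v) ⟨
    outTo P v + outTo (v ∷ R) v        ≡⟨ sumOver-++ P (v ∷ R) (deg v) ⟨
    outTo (P ++ v ∷ R) v               ≡⟨ outTo-ordering ord v ⟩
    outdeg G v                         ∎
    where open ≡-Reasoning

  configOf-at : ∀ P {v} R → v ∉ P → configOf (P ++ v ∷ R) v ≡ inFrom R v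
  configOf-at P {v} R v∉P = trans (configOf-++-∉ P v∉P) (configOf-head v R)

  ordering-swap : ∀ P {A R} → IsOrdering (P ++ A ++ R) → IsOrdering (P ++ R ++ A)
  ordering-swap P {A} {R} ord = ↭-trans (++⁺ˡ P (++-comm R A)) ord

  backArcs : List Vertex → ℕ
  backArcs []      = 0
  backArcs (w ∷ ρ) = inFrom ρ w + backArcs ρ

  arcs : List Vertex → List Vertex → ℕ
  arcs xs ys = sumOver ys (inFrom xs)

  backArcs-++ : ∀ xs ys → backArcs (xs ++ ys) ≡ backArcs xs + backArcs ys + arcs ys xs
  backArcs-++ []       ys = sym (+-identityʳ (backArcs ys))
  backArcs-++ (x ∷ xs) ys = begin
    inFrom (xs ++ ys) x + backArcs (xs ++ ys)
      ≡⟨ cong₂ _+_ (sumOver-++ xs ys _) (backArcs-++ xs ys) ⟩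
    inFrom xs x + inFrom ys x + (backArcs xs + backArcs ys + arcs ys xs)
      ≡⟨ rearrange (inFrom xs x) (inFrom ys x) (backArcs xs) (backArcs ys) (arcs ys xs) ⟩
    inFrom xs x + backArcs xs + backArcs ys + (inFrom ys x + arcs ys xs)
      ∎
    where
    open ≡-Reasoning
    rearrange : ∀ a b c d e → a + b + (c + d + e) ≡ a + c + d + (b + e)
    rearrange = solve-∀

  sumOver-configOf : ∀ {π} → Unique π → sumOver π (configOf π) ≡ backArcs π
  sumOver-configOf {[]}    _          = refl
  sumOver-configOf {w ∷ ρ} (w∉ρ ∷ u) = cong₂ _+_ (configOf-head w ρ)
    (trans (sumOver-cong ρ (λ v∈ → configOf-tail ρ (λ { refl → All.lookup w∉ρ v∈ refl })))
           (sumOver-configOf u))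

  backArcs≡configOf+weight : ∀ {π} s → IsOrdering π → backArcs π ≡ configOf π s + weight G s (configOf π)
  backArcs≡configOf+weight {π} s p = begin
    backArcs π                                  ≡⟨ sumOver-configOf (ordering-unique p) ⟨
    sumOver π (configOf π)                      ≡⟨ sumOver-↭ (configOf π) p ⟩
    sumOver vertices (configOf π)               ≡⟨ sumOver-remove _≟_ (configOf π) vertices-unique (∈-allFin s) ⟩
    configOf π s + weight G s (configOf π)      ∎
    where open ≡-Reasoning

  -- Firing scripts

  fireAt-other : ∀ {v w} x → w ≢ v → fireAt G v x w ≡ x w + deg v w
  fireAt-other {v} {w} x w≢v with w ≟ v
  ... | yes w≡v = ⊥-elim (w≢v w≡v)
  ... | no  _   = refl

  fireSink-nonsink : ∀ {s w} v x → w ≢ s → fireSink G s v x w ≡ fireAt G v x w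
  fireSink-nonsink {s} {w} v x w≢s with w ≟ s
  ... | yes w≡s = ⊥-elim (w≢s w≡s)
  ... | no  _   = refl

  fireSink-other : ∀ {s v w} x → v ≢ s → v ≢ w → fireSink G s w x v ≡ x v + deg w v
  fireSink-other {w = w} x v≢s v≢w = trans (fireSink-nonsink w x v≢s) (fireAt-other x v≢w)

  point : Vertex → Vertex → ℕ
  point w v with v ≟ w
  ... | yes _ = 1
  ... | no  _ = 0

  point-self : ∀ w → point w w ≡ 1
  point-self w with w ≟ w
  ... | yes _  = refl
  ... | no w≢w = ⊥-elim (w≢w refl)

  point-other : ∀ {w v} → v ≢ w → point w v ≡ 0
  point-other {w} {v} v≢w with v ≟ w
  ... | yes v≡w = ⊥-elim (v≢w v≡w)
  ... | no  _   = refl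

  fireAt-balance : ∀ {w} x → outdeg G w ≤ x w → ∀ v → x v + deg w v ≡ fireAt G w x v + outdeg G v * point w v
  fireAt-balance {w} x fireable v with v ≟ w
  ... | yes refl = begin
    x v + deg v v                  ≡⟨ cong (x v +_) (noLoops v) ⟩
    x v + 0                        ≡⟨ +-identityʳ (x v) ⟩
    x v                            ≡⟨ m∸n+n≡m fireable ⟨
    x v ∸ outdeg G v + outdeg G v  ≡⟨ cong (x v ∸ outdeg G v +_) (*-identityʳ (outdeg G v)) ⟨
    x v ∸ outdeg G v + outdeg G v * 1  ∎
    where open ≡-Reasoning
  ... | no _ = sym (trans (cong (x v + deg w v +_) (*-zeroʳ (outdeg G v))) (+-identityʳ _))

  inflow : (Vertex → ℕ) → Vertex → ℕ
  inflow f v = sumOver vertices (λ u → deg u v * f u)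

  inflow-zero : ∀ v → inflow (λ _ → 0) v ≡ 0
  inflow-zero v = sumOver-zero vertices (λ {u} _ → *-zeroʳ (deg u v))

  inflow-cong : ∀ {f g} → f ≗ g → ∀ v → inflow f v ≡ inflow g v
  inflow-cong f≗g v = sumOver-cong vertices (λ {u} _ → cong (deg u v *_) (f≗g u))

  inflow-+point : ∀ f w v → inflow (λ u → f u + point w u) v ≡ deg w v + inflow f v
  inflow-+point f w v = begin
    sumOver vertices (λ u → deg u v * (f u + point w u))
      ≡⟨ sumOver-cong vertices (λ {u} _ → *-distribˡ-+ (deg u v) (f u) (point w u)) ⟩
    sumOver vertices (λ u → deg u v * f u + deg u v * point w u)
      ≡⟨ sumOver-+ vertices _ _ ⟩
    inflow f v + sumOver vertices (λ u → deg u v * point w u)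
      ≡⟨ cong (inflow f v +_) (sumOver-single _ vertices-unique (∈-allFin w)
                                 (λ {u} u≢w → trans (cong (deg u v *_) (point-other u≢w)) (*-zeroʳ (deg u v)))) ⟩
    inflow f v + deg w v * point w w
      ≡⟨ cong (λ k → inflow f v + deg w v * k) (point-self w) ⟩
    inflow f v + deg w v * 1
      ≡⟨ cong (inflow f v +_) (*-identityʳ (deg w v)) ⟩
    inflow f v + deg w v
      ≡⟨ +-comm (inflow f v) (deg w v) ⟩
    deg w v + inflow f v ∎
    where open ≡-Reasoning

  FiringScript : Vertex → (Vertex → ℕ) → Config G → Config G → Set
  FiringScript s f X Y = f s ≡ 0 × (∀ v → v ≢ s → X v + inflow f v ≡ Y v + outdeg G v * f v)

  firing-balance : ∀ {s u} X f → outdeg G u ≤ X u → ∀ {v} → v ≢ s →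
                   X v + inflow (λ w → f w + point u w) v ≡ fireSink G s u X v + inflow f v + outdeg G v * point u v
  firing-balance {s} {u} X f fireable {v} v≢s = begin
    X v + inflow (λ w → f w + point u w) v               ≡⟨ cong (X v +_) (inflow-+point f u v) ⟩
    X v + (deg u v + inflow f v)                         ≡⟨ +-assoc (X v) _ _ ⟨
    X v + deg u v + inflow f v                           ≡⟨ cong (_+ inflow f v) (fireAt-balance X fireable v) ⟩
    fireAt G u X v + outdeg G v * point u v + inflow f v ≡⟨ xy∙z≈xz∙y (fireAt G u X v) _ (inflow f v) ⟩
    fireAt G u X v + inflow f v + outdeg G v * point u v
      ≡⟨ cong (λ k → k + inflow f v + outdeg G v * point u v) (fireSink-nonsink u X v≢s) ⟨
    fireSink G s u X v + inflow f v + outdeg G v * point u v ∎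
    where open ≡-Reasoning

  firings⇒script : ∀ {s X Y} → Star (SinkStep G s) X Y → ∃[ f ] FiringScript s f X Y
  firings⇒script {X = X} ε = (λ _ → 0) , refl , λ v _ →
    cong (X v +_) (trans (inflow-zero v) (sym (*-zeroʳ (outdeg G v))))
  firings⇒script {s} {X} {Y} ((u , u≢s , fireable , refl) ◅ rest) with firings⇒script rest
  ... | f , f-sink , balance = (λ w → f w + point u w) ,
                               cong₂ _+_ f-sink (point-other (λ s≡u → u≢s (sym s≡u))) ,
                               λ v v≢s → trans (firing-balance X f fireable v≢s)
                                 (trans (cong (_+ outdeg G v * point u v) (balance v v≢s))
                                        (sym (+-*-distribˡ (Y v) (outdeg G v) (f v) (point u v))))

  ≤-argmax : ∀ (f : Vertex → ℕ) default y → f y ≤ f (argmax f default vertices)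
  ≤-argmax f default y = All.lookup (f[xs]≤f[argmax] default vertices) (∈-allFin y)

  first-maximum : ∀ (f : Vertex → ℕ) (default : Vertex) {π} → IsOrdering π →
                  ∃[ A ] ∃[ u ] ∃[ C ] π ≡ A ++ u ∷ C × All (λ a → f a < f u) A × (∀ y → f y ≤ f u)
  first-maximum f default {π} ord with First.first (λ y → m≤n⇒m<n∨m≡n (≤-argmax f default y)) π
  ... | inj₂ allBelow = ⊥-elim (<-irrefl refl (All.lookup allBelow (∈-ordering ord (argmax f default vertices))))
  ... | inj₁ firstMax with toView firstMax
  ...   | First._++_∷_ {A} {u} below f-u≡ C =
    A , u , C , refl , All.map (λ {a} fa< → subst (f a <_) (sym f-u≡) fa<) below ,
    λ y → subst (f y ≤_) (sym f-u≡) (≤-argmax f default y)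

  record LastFiringOrder (s : Vertex) (X Y : Config G) : Set where
    field
      order   : List Vertex
      unique  : Unique order
      nonsink : ∀ {v} → v ∈ order → v ≢ s
      fired   : ∀ {v} → v ∈ order → configOf order v ≤ Y v
      unfired : ∀ {v} → v ≢ s → v ∉ order → X v + inFrom order v ≤ Y v

  -- order lists the fired vertices by their last firing.  After its last firing a vertex only
  -- gains chips, one per arc from every vertex whose last firing comes later.
  lastFiringOrder : ∀ {s X Y} → Star (SinkStep G s) X Y → LastFiringOrder s X Y
  lastFiringOrder {X = X} ε =
    record { order = [] ; unique = [] ; nonsink = λ () ; fired = λ ()
           ; unfired = λ _ _ → ≤-reflexive (+-identityʳ (X _)) }
  lastFiringOrder {s} {X} {Y} ((w , w≢s , _ , refl) ◅ rest)
    with L ← lastFiringOrder rest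
       | w ∈? LastFiringOrder.order L
  ... | yes w∈ℓ = record
    { order = order ; unique = unique ; nonsink = nonsink ; fired = fired
    ; unfired = λ v≢s v∉ℓ → ≤-trans (+-monoˡ-≤ _ (X≤ v≢s (λ { refl → v∉ℓ w∈ℓ }))) (unfired v≢s v∉ℓ)
    }
    where
    open LastFiringOrder L
    X≤ : ∀ {v} → v ≢ s → v ≢ w → X v ≤ fireSink G s w X v
    X≤ v≢s v≢w = subst (X _ ≤_) (sym (fireSink-other X v≢s v≢w)) (m≤m+n _ _)
  ... | no  w∉ℓ = record
    { order   = w ∷ order
    ; unique  = ¬Any⇒All¬ order w∉ℓ ∷ unique
    ; nonsink = λ { (here refl) → w≢s ; (there v∈) → nonsink v∈ }
    ; fired   = λ { (here refl) → subst (_≤ Y w) (sym (configOf-head w order))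
                                      (≤-trans (m≤n+m _ _) (unfired w≢s w∉ℓ))
                  ; (there v∈)  → subst (_≤ Y _) (sym (configOf-tail order (λ { refl → w∉ℓ v∈ }))) (fired v∈) }
    ; unfired = λ {v} v≢s v∉ → subst (_≤ Y v)
                  (trans (cong (_+ inFrom order v) (fireSink-other X v≢s (λ v≡w → v∉ (here v≡w))))
                         (+-assoc (X v) _ _))
                  (unfired v≢s (λ v∈ → v∉ (there v∈)))
    }
    where open LastFiringOrder L

  -- Stabilizing an ordering configuration

  -- Stated for every x pointwise equal to configOf π: KeepStep compares configurations with
  -- _≡_, and function extensionality is not available.
  record KeepFires (h : Vertex) (π π′ : List Vertex) : Set where
    constructor keepFires
    field
      run : ∀ {x} → x ≗ configOf π → ∃[ y ] Star (KeepStep G h) x y × y ≗ configOf π′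

  keepFires-reflexive : ∀ {h π π′} → π ≡ π′ → KeepFires h π π′
  keepFires-reflexive refl = keepFires λ {x} x≗ → x , ε , x≗

  keepFires-trans : ∀ {h π π′ π″} → KeepFires h π π′ → KeepFires h π′ π″ → KeepFires h π π″
  keepFires-trans (keepFires fires) (keepFires fires′) = keepFires λ x≗ →
    let y , steps , y≗ = fires x≗
        z , steps′ , z≗ = fires′ y≗
    in z , steps ◅◅ steps′ , z≗

  StableOn : List Vertex → List Vertex → Set
  StableOn P₀ π = ∀ {w} → w ∈ P₀ → configOf π w < outdeg G w

  stableOn-↭ : ∀ {h} P₀ {X Y} → X ↭ Y → StableOn P₀ (h ∷ P₀ ++ X) → StableOn P₀ (h ∷ P₀ ++ Y)
  stableOn-↭ {h} P₀ X↭Y stable w∈ =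
    subst (_< outdeg G _) (configOf-++-↭ (h ∷ P₀) (there w∈) X↭Y) (stable w∈)

  Detached : List Vertex → Vertex → Set
  Detached P w = inFrom P w ≡ 0 × outTo P w ≡ 0

  Attached : List Vertex → Vertex → Set
  Attached P w = 0 < inFrom P w ⊎ (inFrom P w ≡ 0 × 0 < outTo P w)

  detached-or-attached : ∀ P w → Detached P w ⊎ Attached P w
  detached-or-attached P w with inFrom P w | outTo P w
  ... | suc _ | _     = inj₂ (inj₁ (s≤s z≤n))
  ... | zero  | zero  = inj₁ (refl , refl)
  ... | zero  | suc _ = inj₂ (inj₂ (refl , s≤s z≤n))

  adjacent⇒¬detached : ∀ {P a b} → a ∈ P → Adj G a b → ¬ Detached P b
  adjacent⇒¬detached a∈P (inj₁ a→b) (noIn , _)  =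
    <-irrefl refl (≤-trans a→b (subst (_ ≤_) noIn (∈⇒≤sumOver (λ u → deg u _) a∈P)))
  adjacent⇒¬detached a∈P (inj₂ b→a) (_ , noOut) =
    <-irrefl refl (≤-trans b→a (subst (_ ≤_) noOut (∈⇒≤sumOver (deg _) a∈P)))

  path-leaves : ∀ {P x y} → Star (Adj G) x y → x ∈ P → y ∉ P → ∃[ b ] b ∉ P × ¬ Detached P b
  path-leaves ε x∈ y∉ = ⊥-elim (y∉ x∈)
  path-leaves {P} (_◅_ {j = z} x~z z⇝y) x∈ y∉ with z ∈? P
  ... | yes z∈ = path-leaves z⇝y z∈ y∉
  ... | no  z∉ = z , z∉ , adjacent⇒¬detached x∈ x~z

  some-attached : Connected G → ∀ {P R h r} → IsOrdering (P ++ R) → h ∈ P → r ∈ R → ¬ All (Detached P) R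
  some-attached connected {P} ord h∈P r∈R allDetached
    with b , b∉P , ¬detached ← path-leaves (connected _ _) h∈P
                                  (λ r∈P → ++-disjoint P (ordering-unique ord) r∈P r∈R)
    with ∈-++⁻ P (∈-ordering ord b)
  ... | inj₁ b∈P = b∉P b∈P
  ... | inj₂ b∈R = ¬detached (All.lookup allDetached b∈R)

  record Stabilization (h : Vertex) (π : List Vertex) : Set where
    field
      rest     : List Vertex
      ordering : IsOrdering (h ∷ rest)
      stable   : Stable G h (configOf (h ∷ rest))
      fewer    : backArcs (h ∷ rest) ≤ backArcs π
      fires    : backArcs (h ∷ rest) ≡ backArcs π → KeepFires h π (h ∷ rest)

  stabilization-≡ : ∀ {h π π₁} → KeepFires h π π₁ → backArcs π₁ ≡ backArcs π →
                    Stabilization h π₁ → Stabilization h π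
  stabilization-≡ fires₁ same S = record
    { rest = rest ; ordering = ordering ; stable = stable
    ; fewer = subst (_ ≤_) same fewer
    ; fires = λ eq → keepFires-trans fires₁ (fires (trans eq (sym same))) }
    where open Stabilization S

  stabilization-< : ∀ {h π π₁} → backArcs π₁ < backArcs π → Stabilization h π₁ → Stabilization h π
  stabilization-< smaller S = record
    { rest = rest ; ordering = ordering ; stable = stable
    ; fewer = ≤-trans fewer (<⇒≤ smaller)
    ; fires = λ eq → ⊥-elim (<-irrefl eq (≤-<-trans fewer smaller)) }
    where open Stabilization S

  module _ (eulerian : Eulerian G) where

    inFrom-split : ∀ P {v} R → IsOrdering (P ++ v ∷ R) → inFrom P v + inFrom R v ≡ outdeg G v
    inFrom-split P {v} R ord = begin
      inFrom P v + inFrom R v            ≡⟨ cong (λ k → inFrom P v + (k + inFrom R v)) (noLoops v) ⟨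
      inFrom P v + inFrom (v ∷ R) v      ≡⟨ sumOver-++ P (v ∷ R) (λ u → deg u v) ⟨
      inFrom (P ++ v ∷ R) v              ≡⟨ inFrom-ordering ord v ⟩
      indeg G v                          ≡⟨ proj₂ eulerian v ⟩
      outdeg G v                         ∎
      where open ≡-Reasoning

    configOf-first : ∀ {h ρ} → IsOrdering (h ∷ ρ) → configOf (h ∷ ρ) h ≡ outdeg G h
    configOf-first {h} {ρ} ord = trans (configOf-head h ρ) (inFrom-split [] ρ ord)

    module MoveToEnd (P : List Vertex) (v : Vertex) (R : List Vertex)
                     (ord : IsOrdering (P ++ v ∷ R)) (noIn : inFrom P v ≡ 0) where

      π π′ : List Vertex
      π  = P ++ v ∷ R
      π′ = P ++ R ++ [ v ]

      v∉P : v ∉ P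
      v∉P = proj₁ (unique-middle P (ordering-unique ord))

      v∉R : v ∉ R
      v∉R = proj₂ (unique-middle P (ordering-unique ord))

      ordering′ : IsOrdering π′
      ordering′ = ↭-trans (++⁺ˡ P (++-comm R [ v ])) ord

      inFrom-R : inFrom R v ≡ outdeg G v
      inFrom-R = trans (sym (cong (_+ inFrom R v) noIn)) (inFrom-split P R ord)

      configOf-mover : configOf π v ≡ outdeg G v
      configOf-mover = trans (configOf-at P R v∉P) inFrom-R

      configOf′-mover : configOf π′ v ≡ 0
      configOf′-mover = trans (configOf-++-∉ P v∉P) (trans (configOf-++-∉ R v∉R) (configOf-head v []))

      configOf′-P : ∀ {w} → w ∈ P → configOf π′ w ≡ configOf π w
      configOf′-P w∈P = configOf-++-↭ P w∈P (++-comm R [ v ])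

      configOf′-R : ∀ {w} → w ∈ R → configOf π′ w ≡ configOf π w + deg v w
      configOf′-R {w} w∈R = begin
        configOf (P ++ R ++ [ v ]) w    ≡⟨ configOf-++-∉ P w∉P ⟩
        configOf (R ++ [ v ]) w         ≡⟨ configOf-++-∈ R [ v ] w∈R ⟩
        configOf R w + (deg v w + 0)    ≡⟨ cong (configOf R w +_) (+-identityʳ (deg v w)) ⟩
        configOf R w + deg v w          ≡⟨ cong (_+ deg v w) (configOf-tail R w≢v) ⟨
        configOf (v ∷ R) w + deg v w    ≡⟨ cong (_+ deg v w) (configOf-++-∉ P w∉P) ⟨
        configOf π w + deg v w          ∎
        where
        open ≡-Reasoning
        w∉P : w ∉ P
        w∉P w∈P = ++-disjoint P (ordering-unique ord) w∈P (there w∈R)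
        w≢v : w ≢ v
        w≢v refl = v∉R w∈R

      backArcs-moved : backArcs π ≡ backArcs π′ + outTo P v
      backArcs-moved = begin
        backArcs (P ++ v ∷ R)
          ≡⟨ backArcs-++ P (v ∷ R) ⟩
        backArcs P + (inFrom R v + backArcs R) + arcs (v ∷ R) P
          ≡⟨ cong₂ (λ a b → backArcs P + (a + backArcs R) + b)
                   (trans inFrom-R (sym (outTo-split P R ord))) (sumOver-+ P (deg v) (inFrom R)) ⟩
        backArcs P + (outTo P v + outTo R v + backArcs R) + (outTo P v + arcs R P)
          ≡⟨ rearrange (backArcs P) (backArcs R) (arcs R P) (outTo P v) (outTo R v) ⟩
        backArcs P + (backArcs R + 0 + outTo R v) + (arcs R P + outTo P v) + outTo P v
          ≡⟨ cong (_+ outTo P v) backArcs′ ⟨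
        backArcs π′ + outTo P v
          ∎
        where
        open ≡-Reasoning
        rearrange : ∀ bP bR aRP oP oR → bP + (oP + oR + bR) + (oP + aRP) ≡ bP + (bR + 0 + oR) + (aRP + oP) + oP
        rearrange = solve-∀
        deg-v+0 : ∀ Q → sumOver Q (λ x → deg v x + 0) ≡ outTo Q v
        deg-v+0 Q = sumOver-cong Q (λ _ → +-identityʳ _)
        backArcs′ : backArcs π′ ≡ backArcs P + (backArcs R + 0 + outTo R v) + (arcs R P + outTo P v)
        backArcs′ = begin
          backArcs (P ++ R ++ [ v ])
            ≡⟨ backArcs-++ P (R ++ [ v ]) ⟩
          backArcs P + backArcs (R ++ [ v ]) + arcs (R ++ [ v ]) P
            ≡⟨ cong₂ (λ a b → backArcs P + a + b)
                     (trans (backArcs-++ R [ v ]) (cong (backArcs R + 0 +_) (deg-v+0 R)))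
                     (trans (sumOver-cong P (λ _ → sumOver-++ R [ v ] _))
                            (trans (sumOver-+ P (inFrom R) _) (cong (arcs R P +_) (deg-v+0 P)))) ⟩
          backArcs P + (backArcs R + 0 + outTo R v) + (arcs R P + outTo P v)
            ∎

      fire-mover : ∀ {h} → v ≢ h → outTo P v ≡ 0 → KeepFires h π π′
      fire-mover v≢h noOut = keepFires λ {x} x≗ →
        fireAt G v x , (v , v≢h , ≤-reflexive (sym (trans (x≗ v) configOf-mover)) , refl) ◅ ε , fired x≗
        where
        fired : ∀ {x} → x ≗ configOf π → fireAt G v x ≗ configOf π′
        fired x≗ w with w ≟ v
        ... | yes refl = trans (cong (_∸ outdeg G w) (trans (x≗ w) configOf-mover))
                               (trans (n∸n≡0 (outdeg G w)) (sym configOf′-mover))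
        ... | no w≢v with ∈-++⁻ P (∈-ordering ord w)
        ...   | inj₁ w∈P          = trans (cong₂ _+_ (x≗ w) (n≤0⇒n≡0 (subst (deg v w ≤_) noOut (∈⇒≤sumOver (deg v) w∈P))))
                                          (trans (+-identityʳ _) (sym (configOf′-P w∈P)))
        ...   | inj₂ (here w≡v)   = ⊥-elim (w≢v w≡v)
        ...   | inj₂ (there w∈R)  = trans (cong (_+ deg v w) (x≗ w)) (sym (configOf′-R w∈R))

    fire-detached : ∀ {h} P A R → IsOrdering (P ++ A ++ R) → All (Detached P) A → h ∉ A →
                    KeepFires h (P ++ A ++ R) (P ++ R ++ A) × backArcs (P ++ A ++ R) ≡ backArcs (P ++ R ++ A)
    fire-detached P [] R _ [] _ =
      keepFires-reflexive (cong (P ++_) R≡R++[]) , cong (λ X → backArcs (P ++ X)) R≡R++[]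
      where
      R≡R++[] : R ≡ R ++ []
      R≡R++[] = sym (++-identityʳ R)
    fire-detached {h} P (a ∷ A) R ord ((noIn , noOut) ∷ detached) h∉ =
      keepFires-trans (fire-mover (λ a≡h → h∉ (here (sym a≡h))) noOut)
        (keepFires-trans (keepFires-reflexive (cong (P ++_) reassoc))
          (keepFires-trans (proj₁ rest) (keepFires-reflexive (cong (P ++_) (++-assoc R [ a ] A))))) ,
      (begin
        backArcs (P ++ a ∷ A ++ R)                ≡⟨ backArcs-moved ⟩
        backArcs (P ++ (A ++ R) ++ [ a ]) + outTo P a ≡⟨ cong₂ _+_ (cong (λ X → backArcs (P ++ X)) reassoc) noOut ⟩
        backArcs (P ++ A ++ R ++ [ a ]) + 0        ≡⟨ +-identityʳ _ ⟩
        backArcs (P ++ A ++ R ++ [ a ])            ≡⟨ proj₂ rest ⟩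
        backArcs (P ++ (R ++ [ a ]) ++ A)          ≡⟨ cong (λ X → backArcs (P ++ X)) (++-assoc R [ a ] A) ⟩
        backArcs (P ++ R ++ a ∷ A)                 ∎)
      where
      open ≡-Reasoning
      open MoveToEnd P a (A ++ R) ord noIn
      reassoc : (A ++ R) ++ [ a ] ≡ A ++ R ++ [ a ]
      reassoc = ++-assoc A R [ a ]
      rest : KeepFires h (P ++ A ++ R ++ [ a ]) (P ++ (R ++ [ a ]) ++ A) ×
             backArcs (P ++ A ++ R ++ [ a ]) ≡ backArcs (P ++ (R ++ [ a ]) ++ A)
      rest = fire-detached P A (R ++ [ a ]) (subst (λ X → IsOrdering (P ++ X)) reassoc ordering′)
                           detached (λ h∈A → h∉ (there h∈A))

    stabilization-detached : ∀ {h} P₀ R → IsOrdering (h ∷ P₀ ++ R) → StableOn P₀ (h ∷ P₀ ++ R) →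
                             All (Detached (h ∷ P₀)) R → Stabilization h (h ∷ P₀ ++ R)
    stabilization-detached {h} P₀ [] ord stableP _ = record
      { rest = P₀ ++ [] ; ordering = ord ; stable = stable ; fewer = ≤-refl ; fires = λ _ → keepFires-reflexive refl }
      where
      stable : Stable G h (configOf (h ∷ P₀ ++ []))
      stable w w≢h with ∈-ordering ord w
      ... | here w≡h = ⊥-elim (w≢h w≡h)
      ... | there w∈ = stableP (subst (w ∈_) (++-identityʳ P₀) w∈)
    stabilization-detached P₀ (r ∷ R) ord _ allDetached =
      ⊥-elim (some-attached (proj₁ eulerian) {P = _ ∷ P₀} ord (here refl) (here refl) allDetached)

    -- Invariant: the vertices of P₀ are stable.  The fuels b and ℓ bound backArcs and the length
    -- of R; extending the prefix keeps backArcs and shortens R, the other case lowers backArcs.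
    mutual
      stabilize : ∀ (b ℓ : ℕ) {h} P₀ R → IsOrdering (h ∷ P₀ ++ R) → StableOn P₀ (h ∷ P₀ ++ R) →
                  backArcs (h ∷ P₀ ++ R) ≤ b → length R ≤ ℓ → Stabilization h (h ∷ P₀ ++ R)
      stabilize b ℓ {h} P₀ R ord stableP b≤ ℓ≤ with First.first (detached-or-attached (h ∷ P₀)) R
      ... | inj₂ allDetached = stabilization-detached P₀ R ord stableP allDetached
      ... | inj₁ firstAttached with toView firstAttached
      ...   | First._++_∷_ {A} {v} detached attached R″ =
        stabilization-≡ (proj₁ fired) (sym (proj₂ fired))
          (extend-or-lower b ℓ P₀ v (R″ ++ A)
             (ordering-swap (h ∷ P₀) {A} {v ∷ R″} ord) (stableOn-↭ P₀ A↭ stableP)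
             (subst (_≤ b) (proj₂ fired) b≤) (subst (_≤ ℓ) (↭-length A↭) ℓ≤) attached)
        where
        A↭ : A ++ v ∷ R″ ↭ v ∷ R″ ++ A
        A↭ = ++-comm A (v ∷ R″)
        h∉A : h ∉ A
        h∉A h∈A = ++-disjoint (h ∷ P₀) (ordering-unique ord) (here refl) (∈-++⁺ˡ h∈A)
        fired : KeepFires h (h ∷ P₀ ++ A ++ v ∷ R″) (h ∷ P₀ ++ v ∷ R″ ++ A) ×
                backArcs (h ∷ P₀ ++ A ++ v ∷ R″) ≡ backArcs (h ∷ P₀ ++ v ∷ R″ ++ A)
        fired = fire-detached (h ∷ P₀) A (v ∷ R″) ord detached h∉A

      extend-or-lower : ∀ (b ℓ : ℕ) {h} P₀ v R′ →
                        IsOrdering (h ∷ P₀ ++ v ∷ R′) → StableOn P₀ (h ∷ P₀ ++ v ∷ R′) →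
                        backArcs (h ∷ P₀ ++ v ∷ R′) ≤ b → length (v ∷ R′) ≤ ℓ → Attached (h ∷ P₀) v →
                        Stabilization h (h ∷ P₀ ++ v ∷ R′)
      extend-or-lower b (suc ℓ) {h} P₀ v R′ ord stableP b≤ (s≤s ℓ≤) (inj₁ inFrom>0) =
        subst (Stabilization h) reassoc
          (stabilize b ℓ (P₀ ++ [ v ]) R′ (subst IsOrdering (sym reassoc) ord) stable′
                     (subst (λ π → backArcs π ≤ b) (sym reassoc) b≤) ℓ≤)
        where
        reassoc : h ∷ (P₀ ++ [ v ]) ++ R′ ≡ h ∷ P₀ ++ v ∷ R′
        reassoc = cong (h ∷_) (++-assoc P₀ [ v ] R′)
        v-stable : configOf (h ∷ P₀ ++ v ∷ R′) v < outdeg G v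
        v-stable = subst₂ _<_ (sym (configOf-at (h ∷ P₀) R′ v∉P)) (inFrom-split (h ∷ P₀) R′ ord)
                              (m<n+m (inFrom R′ v) inFrom>0)
          where
          v∉P : v ∉ h ∷ P₀
          v∉P = proj₁ (unique-middle (h ∷ P₀) (ordering-unique ord))
        stable′ : StableOn (P₀ ++ [ v ]) (h ∷ (P₀ ++ [ v ]) ++ R′)
        stable′ {w} w∈ = subst (λ π → configOf π w < outdeg G w) (sym reassoc) (stable-at (∈-++⁻ P₀ w∈))
          where
          stable-at : w ∈ P₀ ⊎ w ∈ [ v ] → configOf (h ∷ P₀ ++ v ∷ R′) w < outdeg G w
          stable-at (inj₁ w∈P₀)       = stableP w∈P₀
          stable-at (inj₂ (here refl)) = v-stable
      extend-or-lower b ℓ {h} P₀ v R′ ord stableP b≤ _ (inj₂ (noIn , outTo>0)) =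
        stabilization-< lower (below b (<-≤-trans lower b≤))
        where
        open MoveToEnd (h ∷ P₀) v R′ ord noIn
        lower : backArcs π′ < backArcs π
        lower = subst (backArcs π′ <_) (sym backArcs-moved) (m<m+n (backArcs π′) outTo>0)
        below : ∀ b → backArcs π′ < b → Stabilization h π′
        below (suc b) π′<b = stabilize b (length (R′ ++ [ v ])) P₀ (R′ ++ [ v ]) ordering′
                                 (stableOn-↭ P₀ (↭-sym (++-comm R′ [ v ])) stableP) (≤-pred π′<b) ≤-refl

    stabilization : ∀ h {π} → IsOrdering π → Stabilization h π
    stabilization h ord with A , C , refl ← ∈-∃++ (∈-ordering ord h) =
      stabilization-≡ (proj₁ rotated) (sym (proj₂ rotated))
        (stabilize _ _ [] (C ++ A) (ordering-swap [] {A} {h ∷ C} ord) (λ ()) ≤-refl ≤-refl)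
      where
      rotated : KeepFires h (A ++ h ∷ C) (h ∷ C ++ A) × backArcs (A ++ h ∷ C) ≡ backArcs (h ∷ C ++ A)
      rotated = fire-detached [] A (h ∷ C) ord (All.universal (λ _ → refl , refl) A)
                              (proj₁ (unique-middle A (ordering-unique ord)))

    -- Vertices in front of u fire fewer than f u times, so inflow f u + inFrom A u ≤ f u * deg⁻ u;
    -- the balance at u then leaves Z u ≥ inFrom A u + inFrom C u = deg⁺ u.
    first-maximum-fireable : ∀ {A u C} {f : Vertex → ℕ} {Z : Config G} → IsOrdering (A ++ u ∷ C) →
                             All (λ a → f a < f u) A → (∀ y → f y ≤ f u) →
                             Z u + inflow f u ≡ configOf (A ++ u ∷ C) u + outdeg G u * f u → outdeg G u ≤ Z u
    first-maximum-fireable {A} {u} {C} {f} {Z} ord below bounded balance =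
      cancel (Z u) (inflow f u) (inFrom A u) (inFrom C u) (outdeg G u) (f u)
        (trans balance (cong (_+ _) (configOf-at A C u∉A))) inflow-bound (inFrom-split A C ord)
      where
      u∉A : u ∉ A
      u∉A = proj₁ (unique-middle A (ordering-unique ord))
      g : Vertex → ℕ
      g w = deg w u * f w
      inflow-split : inflow f u ≡ sumOver A g + sumOver C g
      inflow-split = begin
        sumOver vertices g                  ≡⟨ sumOver-↭ g ord ⟨
        sumOver (A ++ u ∷ C) g              ≡⟨ sumOver-++ A (u ∷ C) g ⟩
        sumOver A g + (g u + sumOver C g)   ≡⟨ cong (λ k → sumOver A g + (k * f u + sumOver C g)) (noLoops u) ⟩
        sumOver A g + sumOver C g           ∎
        where open ≡-Reasoning
      before : sumOver A g + inFrom A u ≤ f u * inFrom A u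
      before = begin
        sumOver A g + inFrom A u              ≡⟨ sumOver-+ A g (λ w → deg w u) ⟨
        sumOver A (λ w → deg w u * f w + deg w u)
          ≤⟨ sumOver-mono A (λ {w} w∈A → ≤-trans (≤-reflexive (trans (+-comm _ (deg w u)) (sym (*-suc (deg w u) (f w)))))
                                                  (*-monoʳ-≤ (deg w u) (All.lookup below w∈A))) ⟩
        sumOver A (λ w → deg w u * f u)       ≡⟨ sumOver-cong A (λ {w} _ → *-comm (deg w u) (f u)) ⟩
        sumOver A (λ w → f u * deg w u)       ≡⟨ sumOver-* A (f u) (λ w → deg w u) ⟩
        f u * inFrom A u                      ∎
        where open ≤-Reasoning
      after : sumOver C g ≤ f u * inFrom C u
      after = begin
        sumOver C g                      ≤⟨ sumOver-mono C (λ {w} _ → *-monoʳ-≤ (deg w u) (bounded w)) ⟩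
        sumOver C (λ w → deg w u * f u)  ≡⟨ sumOver-cong C (λ {w} _ → *-comm (deg w u) (f u)) ⟩
        sumOver C (λ w → f u * deg w u)  ≡⟨ sumOver-* C (f u) (λ w → deg w u) ⟩
        f u * inFrom C u                 ∎
        where open ≤-Reasoning
      inflow-bound : inflow f u + inFrom A u ≤ f u * outdeg G u
      inflow-bound = begin
        inflow f u + inFrom A u                      ≡⟨ cong (_+ inFrom A u) inflow-split ⟩
        sumOver A g + sumOver C g + inFrom A u       ≡⟨ xy∙z≈xz∙y (sumOver A g) _ _ ⟩
        sumOver A g + inFrom A u + sumOver C g       ≤⟨ +-mono-≤ before after ⟩
        f u * inFrom A u + f u * inFrom C u          ≡⟨ *-distribˡ-+ (f u) _ _ ⟨
        f u * (inFrom A u + inFrom C u)              ≡⟨ cong (f u *_) (inFrom-split A C ord) ⟩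
        f u * outdeg G u                             ∎
        where open ≤-Reasoning
      cancel : ∀ z i a c o m → z + i ≡ c + o * m → i + a ≤ m * o → a + c ≡ o → o ≤ z
      cancel z i a c o m balanced bound split = +-cancelʳ-≤ (o * m) o z (begin
        o + o * m          ≡⟨ cong (_+ o * m) split ⟨
        a + c + o * m      ≡⟨ +-assoc a c _ ⟩
        a + (c + o * m)    ≡⟨ cong (a +_) balanced ⟨
        a + (z + i)        ≡⟨ x∙yz≈y∙xz a z i ⟩
        z + (a + i)        ≡⟨ cong (z +_) (+-comm a i) ⟩
        z + (i + a)        ≤⟨ +-monoʳ-≤ z bound ⟩
        z + m * o          ≡⟨ cong (z +_) (*-comm m o) ⟩
        z + o * m          ∎)
        where open ≤-Reasoning

    -- Fire the first vertex of π with the largest script value; N is the total script size.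
    script⇒firings : ∀ {s π Z f} N → IsOrdering π → sumOver vertices f ≡ N → FiringScript s f Z (configOf π) →
                     ∃[ e ] Star (SinkStep G s) Z e × (∀ v → v ≢ s → e v ≡ configOf π v)
    script⇒firings {s} {π} {Z} {f} zero _ Σf≡0 (_ , balance) = Z , ε , λ v v≢s → begin
      Z v                              ≡⟨ +-identityʳ (Z v) ⟨
      Z v + 0                          ≡⟨ cong (Z v +_) (trans (inflow-cong f≡0 v) (inflow-zero v)) ⟨
      Z v + inflow f v                 ≡⟨ balance v v≢s ⟩
      configOf π v + outdeg G v * f v  ≡⟨ cong (λ k → configOf π v + outdeg G v * k) (f≡0 v) ⟩
      configOf π v + outdeg G v * 0    ≡⟨ cong (configOf π v +_) (*-zeroʳ (outdeg G v)) ⟩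
      configOf π v + 0                 ≡⟨ +-identityʳ (configOf π v) ⟩
      configOf π v                     ∎
      where
      open ≡-Reasoning
      f≡0 : ∀ u → f u ≡ 0
      f≡0 u = n≤0⇒n≡0 (subst (f u ≤_) Σf≡0 (∈⇒≤sumOver f (∈-allFin u)))
    script⇒firings {s} {π} {Z} {f} (suc N) ord Σf≡1+N (f-sink , balance)
      with A , u , C , refl , below , bounded ← first-maximum f s ord =
      let e , steps , e≐ = script⇒firings N ord Σf′≡N (f′-sink , balance′)
      in  e , (u , u≢s , fireable , refl) ◅ steps , e≐
      where
      0<f-u : 0 < f u
      0<f-u = n≢0⇒n>0 λ f-u≡0 → 1+n≢0 (trans (sym Σf≡1+N)
                (sumOver-zero vertices (λ {y} _ → n≤0⇒n≡0 (subst (f y ≤_) f-u≡0 (bounded y)))))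
      u≢s : u ≢ s
      u≢s refl = <-irrefl (sym f-sink) 0<f-u
      fireable : outdeg G u ≤ Z u
      fireable = first-maximum-fireable {Z = Z} ord below bounded (balance u u≢s)
      f′ : Vertex → ℕ
      f′ w = f w ∸ point u w
      point≤f : ∀ w → point u w ≤ f w
      point≤f w with w ≟ u
      ... | yes refl = 0<f-u
      ... | no _     = z≤n
      f≡f′+point : ∀ w → f w ≡ f′ w + point u w
      f≡f′+point w = sym (m∸n+n≡m (point≤f w))
      f′-sink : f′ s ≡ 0
      f′-sink = trans (cong (_∸ point u s) f-sink) (0∸n≡0 (point u s))
      Σf′≡N : sumOver vertices f′ ≡ N
      Σf′≡N = suc-injective (begin
        suc (sumOver vertices f′)                            ≡⟨ +-comm 1 _ ⟩
        sumOver vertices f′ + 1                              ≡⟨ cong (sumOver vertices f′ +_) point-total ⟨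
        sumOver vertices f′ + sumOver vertices (point u)     ≡⟨ sumOver-+ vertices f′ (point u) ⟨
        sumOver vertices (λ w → f′ w + point u w)            ≡⟨ sumOver-cong vertices (λ {w} _ → f≡f′+point w) ⟨
        sumOver vertices f                                   ≡⟨ Σf≡1+N ⟩
        suc N                                                ∎)
        where
        open ≡-Reasoning
        point-total : sumOver vertices (point u) ≡ 1
        point-total = trans (sumOver-single (point u) vertices-unique (∈-allFin u) point-other) (point-self u)
      balance′ : ∀ v → v ≢ s → fireSink G s u Z v + inflow f′ v ≡ configOf (A ++ u ∷ C) v + outdeg G v * f′ v
      balance′ v v≢s = +-cancelʳ-≡ (outdeg G v * point u v) _ _ (begin
        fireSink G s u Z v + inflow f′ v + outdeg G v * point u v  ≡⟨ firing-balance Z f′ fireable v≢s ⟨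
        Z v + inflow (λ w → f′ w + point u w) v                    ≡⟨ cong (Z v +_) (inflow-cong f≡f′+point v) ⟨
        Z v + inflow f v                                           ≡⟨ balance v v≢s ⟩
        c₀ v + outdeg G v * f v                                    ≡⟨ cong (λ k → c₀ v + outdeg G v * k) (f≡f′+point v) ⟩
        c₀ v + outdeg G v * (f′ v + point u v)                     ≡⟨ +-*-distribˡ (c₀ v) (outdeg G v) (f′ v) (point u v) ⟩
        c₀ v + outdeg G v * f′ v + outdeg G v * point u v          ∎)
        where
        open ≡-Reasoning
        c₀ : Config G
        c₀ = configOf (A ++ u ∷ C)

    ordering-recurrent : ∀ {s c π} → Recurrent G s c → IsOrdering π → Stable G s (configOf π) →
                         Recurrent G s (configOf π)
    ordering-recurrent {s} {c} {π} (_ , reach) ord stable = stable , λ d →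
      let d″ , e , (steps , _) , e≐c = reach (_⊕_ G d c)
          f , f-sink , balance = firings⇒script steps
          e′ , steps′ , e′≐ = script⇒firings _ ord refl (f-sink , λ v v≢s →
                                exchange (d v) (c v) (configOf π v) (d″ v) (inflow f v) (outdeg G v * f v)
                                  (trans (balance v v≢s) (cong (_+ outdeg G v * f v) (e≐c v v≢s))))
      in  _⊕_ G (configOf π) d″ , e′ , (steps′ , λ v v≢s → subst (_< outdeg G v) (sym (e′≐ v v≢s)) (stable v v≢s)) , e′≐
      where
      exchange : ∀ d c p d″ i o → d + c + d″ + i ≡ c + o → d + (p + d″) + i ≡ p + o
      exchange d c p d″ i o eq = +-cancelʳ-≡ c _ _ (begin
        d + (p + d″) + i + c  ≡⟨ shuffle₁ d c p d″ i ⟩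
        p + (d + c + d″ + i)  ≡⟨ cong (p +_) eq ⟩
        p + (c + o)           ≡⟨ shuffle₂ p c o ⟩
        p + o + c             ∎)
        where
        open ≡-Reasoning
        shuffle₁ : ∀ d c p d″ i → d + (p + d″) + i + c ≡ p + (d + c + d″ + i)
        shuffle₁ = solve-∀
        shuffle₂ : ∀ p c o → p + (c + o) ≡ p + o + c
        shuffle₂ = solve-∀

    recurrent⇒ordering-below : ∀ {s c} → Recurrent G s c →
                               ∃[ ℓ ] IsOrdering (s ∷ ℓ) × (∀ v → v ≢ s → configOf (s ∷ ℓ) v ≤ c v)
    recurrent⇒ordering-below {s} {c} (_ , reach)
      with d″ , e , (steps , e-stable) , e≐c ← reach (outdeg G) =
      order , unique∧complete⇒ordering (¬Any⇒All¬ order (λ s∈ → nonsink s∈ refl) ∷ unique) complete ,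
      λ v v≢s → subst₂ _≤_ (sym (configOf-tail order v≢s)) (e≐c v v≢s) (fired (fires v≢s))
      where
      open LastFiringOrder (lastFiringOrder steps)
      fires : ∀ {v} → v ≢ s → v ∈ order
      fires {v} v≢s = decidable-stable (v ∈? order) λ v∉ → <-irrefl refl
        (≤-<-trans (≤-trans (m≤m+n (outdeg G v) _) (≤-trans (m≤m+n _ _) (unfired v≢s v∉))) (e-stable v v≢s))
      complete : ∀ v → v ∈ s ∷ order
      complete v with v ≟ s
      ... | yes refl = here refl
      ... | no v≢s   = there (fires v≢s)

    -- Minimum recurrent configurations

    module Minimum {s₁ : Vertex} {c : Config G} (minimum : MinimumRecurrent G s₁ c) where

      nonsinks : List Vertex
      nonsinks = filter (λ v → ¬? (v ≟ s₁)) vertices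

      ∈-nonsinks⁻ : ∀ {v} → v ∈ nonsinks → v ≢ s₁
      ∈-nonsinks⁻ v∈ = proj₂ (∈-filter⁻ (λ v → ¬? (v ≟ s₁)) {xs = vertices} v∈)

      recurrent : Recurrent G s₁ c
      recurrent = proj₁ minimum

      minimal : ∀ c′ → Recurrent G s₁ c′ → weight G s₁ c ≤ weight G s₁ c′
      minimal = proj₂ minimum

      ℓ₀ : List Vertex
      ℓ₀ = proj₁ (recurrent⇒ordering-below recurrent)

      π₀ : List Vertex
      π₀ = s₁ ∷ ℓ₀

      ordering₀ : IsOrdering π₀
      ordering₀ = proj₁ (proj₂ (recurrent⇒ordering-below recurrent))

      below-c : ∀ v → v ≢ s₁ → configOf π₀ v ≤ c v
      below-c = proj₂ (proj₂ (recurrent⇒ordering-below recurrent))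

      configOf₀≡c : ∀ v → v ≢ s₁ → configOf π₀ v ≡ c v
      configOf₀≡c v v≢s₁ =
        ≤-pointwise∧sumOver-≥⇒≡ nonsinks (λ v∈ → below-c _ (∈-nonsinks⁻ v∈))
          (minimal (configOf π₀)
            (ordering-recurrent recurrent ordering₀ (λ w w≢s₁ → ≤-<-trans (below-c w w≢s₁) (proj₁ recurrent w w≢s₁))))
          (∈-filter⁺ (λ v → ¬? (v ≟ s₁)) (∈-allFin v) v≢s₁)

      backArcs₀ : backArcs π₀ ≡ outdeg G s₁ + weight G s₁ c
      backArcs₀ = trans (backArcs≡configOf+weight s₁ ordering₀)
                        (cong₂ _+_ (configOf-first ordering₀) (sumOver-cong nonsinks (λ v∈ → configOf₀≡c _ (∈-nonsinks⁻ v∈))))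

      backArcs₀-minimal : ∀ {π} → IsOrdering π → backArcs π₀ ≤ backArcs π
      backArcs₀-minimal {π} ord = begin
        backArcs π₀                                          ≡⟨ backArcs₀ ⟩
        outdeg G s₁ + weight G s₁ c                          ≤⟨ +-monoʳ-≤ (outdeg G s₁)
                                                                  (minimal _ (ordering-recurrent recurrent ordering stable)) ⟩
        outdeg G s₁ + weight G s₁ (configOf (s₁ ∷ rest))     ≡⟨ cong (_+ weight G s₁ (configOf (s₁ ∷ rest))) (configOf-first ordering) ⟨
        configOf (s₁ ∷ rest) s₁ + weight G s₁ (configOf (s₁ ∷ rest))
                                                             ≡⟨ backArcs≡configOf+weight s₁ ordering ⟨
        backArcs (s₁ ∷ rest)                                 ≤⟨ fewer ⟩
        backArcs π                                           ∎
        where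
        open ≤-Reasoning
        open Stabilization (stabilization s₁ ord)

      lift≗configOf₀ : lift G s₁ c 0 ≗ configOf π₀
      lift≗configOf₀ v with v ≟ s₁
      ... | yes refl = trans (+-identityʳ (outdeg G v)) (sym (inFrom-split [] ℓ₀ ordering₀))
      ... | no v≢s₁  = trans (sym (configOf₀≡c v v≢s₁)) (configOf-tail ℓ₀ v≢s₁)

      swapCond₀ : ∀ s₂ → SwapCond G s₁ s₂ c 0
      swapCond₀ s₂ =
        let y , steps , y≗ = KeepFires.run (fires (≤-antisym fewer (backArcs₀-minimal ordering))) lift≗configOf₀
        in  y , (steps , λ v v≢s₂ → subst (_< outdeg G v) (sym (y≗ v)) (stable v v≢s₂)) ,
            trans (y≗ s₂) (trans (configOf-first ordering) (sym (+-identityʳ (outdeg G s₂))))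
        where open Stabilization (stabilization s₂ ordering₀)

proposition1 : (G : Digraph) → Eulerian G →
    (s₁ s₂ : V G) → s₁ ≢ s₂ →
    (c : Config G) → MinimumRecurrent G s₁ c →
    IsSwapNumber G s₁ s₂ c 0
proposition1 G eulerian s₁ s₂ _ c minimum = swapCond₀ s₂ , λ _ ()
  where open ChipFiring.Minimum G eulerian minimum
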